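{- Let $\mathbf{K}$ be an infinite structure, $\mathbf{K}'$ an expansion of $\mathbf{K}$, and $\mathbf{K}^*$ an expansion of $\mathbf{K}'$ (so $\mathbf{K}^*$ is an expansion of $\mathbf{K}$). (1) If $\mathbf{K}'/\mathbf{K}$ and $\mathbf{K}^*/\mathbf{K}'$ are both recurrent, then $\mathbf{K}^*/\mathbf{K}$ is recurrent. (2) If $\mathbf{K}'/\mathbf{K}$ is recurrent and $\mathbf{K}^*/\mathbf{K}'$ is unavoidable, then $\mathbf{K}^*/\mathbf{K}$ is unavoidable.
   Context: Fix a relational language $\mathbb{L}$: a set of relation symbols $R$, each with an arity $n_R\ge 1$. A structure $\mathbf{A}$ consists of a set $A$ and subsets $R^{\mathbf{A}}\subseteq A^{n_R}$ for $R\in\mathbb{L}$; $\mathcal{L}_{\mathbf{A}}=\{R\in\mathbb{L}: R^{\mathbf{A}}\neq\emptyset\}$. An embedding $f:\mathbf{A}\to\mathbf{B}$ is an injection $f:A\to B$ such that for every $R$ of arity $n$ and $(a_0,\dots,a_{n-1})\in A^n$, $(a_0,\dots,a_{n-1})\in R^{\mathbf{A}}$ iff $(f(a_0),\dots,f(a_{n-1}))\in R^{\mathbf{B}}$. $\mathrm{Emb}(\mathbf{A},\mathbf{B})$ is the set of embeddings, $\mathrm{Emb}(\mathbf{K})=\mathrm{Emb}(\mathbf{K},\mathbf{K})$, and $\mathrm{Age}(\mathbf{K})$ is the class of finite structures embeddable in $\mathbf{K}$. For an injection $\eta:S\to K$, $\mathbf{K}\cdot\eta$ is the unique structure on universe $S$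 with $\eta\in\mathrm{Emb}(\mathbf{K}\cdot\eta,\mathbf{K})$. Given structures $\mathbf{K}^*,\mathbf{K}$ with the same universe, $\mathbf{K}^*$ is an expansion of $\mathbf{K}$ (written $\mathbf{K}^*/\mathbf{K}$) if $R^{\mathbf{K}^*}=R^{\mathbf{K}}$ for all $R\in\mathcal{L}_{\mathbf{K}}$. An expansion $\mathbf{K}^*/\mathbf{K}$ is recurrent if for every $\eta\in\mathrm{Emb}(\mathbf{K})$ there is $\theta\in\mathrm{Emb}(\mathbf{K})$ with $\eta\circ\theta\in\mathrm{Emb}(\mathbf{K}^*)$; it is unavoidable if $\mathrm{Age}(\mathbf{K}^*\cdot\eta)=\mathrm{Age}(\mathbf{K}^*)$ for every $\eta\in\mathrm{Emb}(\mathbf{K})$. -}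

module Defs where

open import Data.Nat using (ℕ; _≤_)
open import Data.Fin using (Fin)
open import Data.Product using (Σ; ∃; _×_)
open import Function.Base using (_∘_; id)
open import Function.Bundles using (_↔_)
open import Relation.Nullary using (¬_)
open import Relation.Binary.PropositionalEquality using (_≡_)

record Lang : Set₁ where
  field
    Sym     : Set
    arity   : Sym → ℕ
    arity≥1 : (R : Sym) → 1 ≤ arity R
open Lang public

record Str (L : Lang) (A : Set) : Set₁ where
  field
    rel : (R : Sym L) → (Fin (arity L R) → A) → Set
open Str public

record IsEmb {L : Lang} {A B : Set} (𝐀 : Str L A) (𝐁 : Str L B) (f : A → B) : Set where
  field
    injective : ∀ x y → f x ≡ f y → x ≡ y
    preserves : ∀ (R : Sym L) (t : Fin (arity L R) → A) → rel 𝐀 R t → rel 𝐁 R (f ∘ t)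
    reflects  : ∀ (R : Sym L) (t : Fin (arity L R) → A) → rel 𝐁 R (f ∘ t) → rel 𝐀 R t
open IsEmb public

Emb : {L : Lang} {A B : Set} → Str L A → Str L B → Set
Emb {A = A} {B = B} 𝐀 𝐁 = Σ (A → B) (IsEmb 𝐀 𝐁)

EmbSelf : {L : Lang} {A : Set} → Str L A → Set
EmbSelf 𝐊 = Emb 𝐊 𝐊

-- R ∈ L_K  iff  R^K is nonempty
InLang : {L : Lang} {A : Set} → Str L A → Sym L → Set
InLang {L} 𝐊 R = ∃ λ (t : Fin (arity L R) → _) → rel 𝐊 R t

-- K* · η : the unique structure on the domain of η making η an embedding into K*.
_·_ : {L : Lang} {S K : Set} → Str L K → (S → K) → Str L S
rel (𝐊 · η) R t = rel 𝐊 R (η ∘ t)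

-- Age(X) = Age(Y): every finite structure (up to isomorphism one on Fin n)
-- embeds into X iff it embeds into Y.
SameAge : {L : Lang} {A B : Set} → Str L A → Str L B → Set₁
SameAge {L} 𝐗 𝐘 =
  ∀ (n : ℕ) (𝐅 : Str L (Fin n)) → (Emb 𝐅 𝐗 → Emb 𝐅 𝐘) × (Emb 𝐅 𝐘 → Emb 𝐅 𝐗)

IsExpansion : {L : Lang} {A : Set} → Str L A → Str L A → Set
IsExpansion {L} 𝐊* 𝐊 =
  ∀ (R : Sym L) → InLang 𝐊 R →
    ∀ (t : Fin (arity L R) → _) → (rel 𝐊* R t → rel 𝐊 R t) × (rel 𝐊 R t → rel 𝐊* R t)

Recurrent : {L : Lang} {A : Set} → Str L A → Str L A → Set
Recurrent 𝐊* 𝐊 =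
  ∀ (η : EmbSelf 𝐊) → Σ (EmbSelf 𝐊) λ θ →
    IsEmb 𝐊* 𝐊* (Data.Product.proj₁ η ∘ Data.Product.proj₁ θ)

Unavoidable : {L : Lang} {A : Set} → Str L A → Str L A → Set₁
Unavoidable 𝐊* 𝐊 = ∀ (η : EmbSelf 𝐊) → SameAge (𝐊* · Data.Product.proj₁ η) 𝐊*

Infinite : Set → Set
Infinite A = ¬ (Σ ℕ λ n → A ↔ Fin n)

{-# OPTIONS --safe #-}
module Submission where

-- Recurrence of 𝐊′/𝐊 replaces a copy η of 𝐊 inside 𝐊 by a subcopy η ∘ θ that is
-- a copy of 𝐊′, where the hypothesis on 𝐊*/𝐊′ applies. For (1), the θ′ it
-- provides is a self-embedding of 𝐊′, hence of its reduct 𝐊, so θ ∘ θ′ works.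
-- For (2), 𝐊* · (η ∘ θ) embeds into 𝐊* · η via θ, and 𝐊* · η into 𝐊* via η, so
-- Age(𝐊*) = Age(𝐊* · (η ∘ θ)) ⊆ Age(𝐊* · η) ⊆ Age(𝐊*).

open import Defs
open import Data.Fin using (Fin)
open import Data.Product using (_×_; _,_; proj₁; proj₂)
open import Function.Base using (_∘_)
open import Relation.Binary.PropositionalEquality using (_≡_)

module _ {L : Lang} where

  IsEmb-∘ : {A B C : Set} {𝐀 : Str L A} {𝐁 : Str L B} {𝐂 : Str L C}
            {f : B → C} {g : A → B} →
            IsEmb 𝐁 𝐂 f → IsEmb 𝐀 𝐁 g → IsEmb 𝐀 𝐂 (f ∘ g)
  IsEmb-∘ {g = g} f-emb g-emb = record
    { injective = λ x y p → injective g-emb x y (injective f-emb _ _ p)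
    ; preserves = λ R t p → preserves f-emb R (g ∘ t) (preserves g-emb R t p)
    ; reflects  = λ R t p → reflects g-emb R t (reflects f-emb R (g ∘ t) p)
    }

  Emb-∘ : {A B C : Set} {𝐀 : Str L A} {𝐁 : Str L B} {𝐂 : Str L C} →
          Emb 𝐁 𝐂 → Emb 𝐀 𝐁 → Emb 𝐀 𝐂
  Emb-∘ (f , f-emb) (g , g-emb) = f ∘ g , IsEmb-∘ f-emb g-emb

  IsEmb-· : {S B : Set} (𝐘 : Str L B) {g : S → B} →
            (∀ x y → g x ≡ g y → x ≡ y) → IsEmb (𝐘 · g) 𝐘 g
  IsEmb-· 𝐘 g-injective = record
    { injective = g-injective
    ; preserves = λ _ _ p → p
    ; reflects  = λ _ _ p → p
    }

  -- A symbol outside L_𝐊 is empty in 𝐊, so the tuple at hand always witnesses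
  -- that the symbol lies in L_𝐊, where 𝐊′ and 𝐊 agree.
  IsEmb-reduct : {A : Set} {𝐊 𝐊′ : Str L A} {h : A → A} →
                 IsExpansion 𝐊′ 𝐊 → IsEmb 𝐊′ 𝐊′ h → IsEmb 𝐊 𝐊 h
  IsEmb-reduct {h = h} 𝐊′/𝐊 h-emb = record
    { injective = injective h-emb
    ; preserves = λ R t p →
        proj₁ (𝐊′/𝐊 R (t , p) (h ∘ t))
              (preserves h-emb R t (proj₂ (𝐊′/𝐊 R (t , p) t) p))
    ; reflects  = λ R t p →
        proj₁ (𝐊′/𝐊 R (h ∘ t , p) t)
              (reflects h-emb R t (proj₂ (𝐊′/𝐊 R (h ∘ t , p) (h ∘ t)) p))
    }

  _⊆Age_ : {A B : Set} → Str L A → Str L B → Set₁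
  𝐗 ⊆Age 𝐘 = ∀ n (𝐅 : Str L (Fin n)) → Emb 𝐅 𝐗 → Emb 𝐅 𝐘

  ·-⊆Age : {S B : Set} (𝐘 : Str L B) {g : S → B} →
           (∀ x y → g x ≡ g y → x ≡ y) → (𝐘 · g) ⊆Age 𝐘
  ·-⊆Age 𝐘 g-injective _ _ = Emb-∘ (_ , IsEmb-· 𝐘 g-injective)

  recurrent-trans : {A : Set} {𝐊 𝐊′ 𝐊* : Str L A} → IsExpansion 𝐊′ 𝐊 →
                    Recurrent 𝐊′ 𝐊 → Recurrent 𝐊* 𝐊′ → Recurrent 𝐊* 𝐊
  recurrent-trans 𝐊′/𝐊 rec′ rec* (η , η-emb) =
    let (θ , θ-emb) , ηθ-emb′ = rec′ (η , η-emb)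
        (θ′ , θ′-emb) , ηθθ′-emb* = rec* (η ∘ θ , ηθ-emb′)
    in (θ ∘ θ′ , IsEmb-∘ θ-emb (IsEmb-reduct 𝐊′/𝐊 θ′-emb)) , ηθθ′-emb*

  recurrent-unavoidable-trans : {A : Set} {𝐊 𝐊′ 𝐊* : Str L A} →
    Recurrent 𝐊′ 𝐊 → Unavoidable 𝐊* 𝐊′ → Unavoidable 𝐊* 𝐊
  recurrent-unavoidable-trans {𝐊* = 𝐊*} rec′ unav* (η , η-emb) n 𝐅 =
    let (θ , θ-emb) , ηθ-emb′ = rec′ (η , η-emb)
    in ·-⊆Age 𝐊* (injective η-emb) n 𝐅
     , ·-⊆Age (𝐊* · η) (injective θ-emb) n 𝐅
       ∘ proj₂ (unav* (η ∘ θ , ηθ-emb′) n 𝐅)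

lemma3p15 : {L : Lang} {A : Set} (𝐊 𝐊′ 𝐊* : Str L A) →
    Infinite A → IsExpansion 𝐊′ 𝐊 → IsExpansion 𝐊* 𝐊′ →
    (Recurrent 𝐊′ 𝐊 → Recurrent 𝐊* 𝐊′ → Recurrent 𝐊* 𝐊) ×
    (Recurrent 𝐊′ 𝐊 → Unavoidable 𝐊* 𝐊′ → Unavoidable 𝐊* 𝐊)
lemma3p15 _ _ _ _ 𝐊′/𝐊 _ = recurrent-trans 𝐊′/𝐊 , recurrent-unavoidable-trans
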